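{- Let $G=(V,E)$ be a finite graph and $f\colon V\to\mathbb{N}$ with $f(v)\le d_G(v)+1$ for all $v\in V$. Suppose there is an independent set $A\subseteq V$ such that every $X\subseteq V(G_A)$ satisfies \[ \|X\|_{G_A}+\|X,V(G_A)\setminus X\|_{G_A}\ge\sum_{v\in X}\bigl(d_G(v)+1-f(v)\bigr). \] Then $G$ is online $f$-choosable.
   Context: For an independent set $A$ of $G$, $G_A$ denotes the spanning bipartite subgraph $G-E(G-A)$ (i.e. $G$ with all edges having both ends outside $A$ removed). For a graph $F$ and $X,Y\subseteq V(F)$, $\|X,Y\|_F:=\sum_{v\in X}|N_F(v)\cap Y|$ and $\|X\|_F$ is the number of edges of $F[X]$. Online $f$-choosability: $G$ is online $f$-choosable if $|G|=0$, or both $f(v)\ge1$ for all $v$ and for every $S\subseteq V$ there is an independent $I\subseteq S$ such that $G-I$ is online $f'$-choosable, where $f'(v)=f(v)$ for $v\notin S$ and $f'(v)=f(v)-1$ for $v\in S\setminus I$. -}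

module Defs where

open import Data.Nat using (ℕ; zero; suc; _+_; _*_; _∸_; _≤_; _<ᵇ_)
open import Data.Bool using (Bool; true; false; _∧_; _∨_; not; if_then_else_)
open import Data.Fin using (Fin; toℕ)
open import Data.Fin.Subset using (Subset; _∈_; _∉_; _⊆_; _─_; Nonempty)
open import Data.Vec using (lookup)
open import Data.List using (List; map; allFin)
open import Data.Nat.ListAction using (sum)
open import Data.Product using (Σ; _×_)
open import Relation.Binary.PropositionalEquality using (_≡_)

record Graph (n : ℕ) : Set where
  field
    Adj    : Fin n → Fin n → Bool
    sym    : ∀ u w → Adj u w ≡ Adj w u
    irrefl : ∀ v → Adj v v ≡ false
open Graph public

Σᵥ : ∀ {n} → (Fin n → ℕ) → ℕ
Σᵥ {n} g = sum (map g (allFin n))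

⟦_⟧ : Bool → ℕ
⟦ true ⟧ = 1
⟦ false ⟧ = 0

deg : ∀ {n} → Graph n → Fin n → ℕ
deg G v = Σᵥ (λ w → ⟦ Adj G v w ⟧)

Independent : ∀ {n} → Graph n → Subset n → Set
Independent G I = ∀ u w → u ∈ I → w ∈ I → Adj G u w ≡ false

-- adjacency in G_A = G - E(G - A): edges of G with at least one end in A
AdjA : ∀ {n} → Graph n → Subset n → Fin n → Fin n → Bool
AdjA G A u w = Adj G u w ∧ (lookup A u ∨ lookup A w)

edgesIn : ∀ {n} → Graph n → Subset n → Subset n → ℕ
edgesIn G A X = Σᵥ (λ u → Σᵥ (λ w →
  ⟦ (toℕ u <ᵇ toℕ w) ∧ lookup X u ∧ lookup X w ∧ AdjA G A u w ⟧))

crossEdges : ∀ {n} → Graph n → Subset n → Subset n → ℕ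
crossEdges G A X = Σᵥ (λ u → ⟦ lookup X u ⟧ * Σᵥ (λ w →
  ⟦ not (lookup X w) ∧ AdjA G A u w ⟧))

reduce : ∀ {n} → Subset n → Subset n → (Fin n → ℕ) → Fin n → ℕ
reduce S I f v = if lookup S v ∧ not (lookup I v) then f v ∸ 1 else f v

-- Online f-choosability of the induced subgraph G[W] (W = set of remaining vertices).
-- The request set S ranges over nonempty subsets (S = ∅ is vacuous).
data OnlineChoosable {n} (G : Graph n) : Subset n → (Fin n → ℕ) → Set where
  empty : ∀ {W f} → (∀ v → v ∉ W) → OnlineChoosable G W f
  step  : ∀ {W f} →
          (∀ v → v ∈ W → 1 ≤ f v) →
          (∀ S → S ⊆ W → Nonempty S →
             Σ (Subset n) λ I → I ⊆ S × Independent G I ×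
               OnlineChoosable G (W ─ I) (reduce S I f)) →
          OnlineChoosable G W f

-- The hypothesis says that every vertex set X meets at least Σ_{v ∈ X} (d(v) + 1 − f(v)) edges
-- of G_A, so by Hakimi's theorem G_A has an orientation in which every vertex v has in-degree at
-- least d(v) + 1 − f(v). Hakimi's theorem follows by deleting the edges one at a time and orienting
-- each towards an endpoint whose demand drops by one; if neither endpoint can take the edge, the two
-- sets witnessing this combine, by submodularity of "number of edges meeting X", into a violation of
-- the Hall condition.
--
-- The game is then won keeping d_W(v) < f(v) + indeg_W(v) for the set W of uncoloured vertices.
-- Against a request S, pick an independent I ⊆ S such that every v ∈ S ∖ I has a neighbour in I
-- that is not an in-neighbour; since every arc meets the independent set A, such an I is found
-- greedily. Removing I lowers d_W(v) at least as much as indeg_W(v), and strictly for v ∈ S ∖ I,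
-- which pays for the colour that v loses.

module Submission where

open import Defs renaming (sym to adj-sym)
open import Data.Nat using (ℕ; zero; suc; _+_; _*_; _∸_; _≤_; _<_; _≥_; z≤n; s≤s; _<ᵇ_; _<?_)
open import Data.Nat.Properties hiding (_≟_)
open import Algebra.Properties.Semiring.Sum +-*-semiring
  using (sum; sum-syntax; ∑-distrib-+; ∑-comm; *-distribˡ-sum; sum-cong-≗; sum-replicate-zero)
import Data.Nat.ListAction as List
import Data.List as List using (map; tabulate)
open import Data.Bool using (Bool; true; false; _∧_; _∨_; not)
import Data.Bool as Bool
open import Data.Bool.Properties using (T-≡; ∨-comm; ¬-not; ∨-identityʳ; ∨-zeroʳ; ∧-zeroʳ; ∧-identityʳ; ∧-conicalˡ; ∧-conicalʳ)
open import Data.Fin using (Fin; zero; suc; toℕ; _≟_)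
open import Data.Fin.Properties using (any?; toℕ-injective)
open import Data.Fin.Subset using (Subset; _∈_; _∉_; _⊆_; _─_; _∩_; _∪_; ⁅_⁆; ⊤; ∣_∣; Nonempty)
open import Data.Fin.Subset.Properties
  using (anySubset?; _∈?_; x∈p∩q⁺; x∈p∩q⁻; p∩q⊆p; x∈p∪q⁺; x∈p∪q⁻; x∈⁅x⁆; x∈⁅y⁆⇒x≡y; p─q⊆p; x∈p∧x∉q⇒x∈p─q; p∩q≢∅⇒∣p─q∣<∣p∣)
open import Data.Vec using (_∷_; lookup; tabulate)
open import Data.Vec.Properties using (lookup∘tabulate; lookup-zipWith; lookup-replicate; []=⇒lookup; lookup⇒[]=)
open import Data.Product using (Σ; ∃₂; ∃-syntax; _×_; _,_; proj₁; proj₂)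
open import Data.Sum using (_⊎_; inj₁; inj₂)
open import Data.Empty using (⊥; ⊥-elim)
open import Function using (_∘_; id; Equivalence)
open import Relation.Unary using (Decidable)
open import Relation.Nullary using (¬_; yes; no; does; contradiction)
open import Relation.Nullary.Decidable using (dec-true; dec-false; ¬?; _×-dec_; decidable-stable)
open import Relation.Binary.PropositionalEquality
open import Relation.Binary.Definitions using (tri<; tri≈; tri>)
import Data.Sum as Sum

private variable n : ℕ

Σᵥ≡∑ : (g : Fin n → ℕ) → Σᵥ g ≡ ∑[ v < n ] g v
Σᵥ≡∑ {n} g = sum-map-tabulate n id
  where
  sum-map-tabulate : ∀ m (h : Fin m → Fin n) → List.sum (List.map g (List.tabulate h)) ≡ ∑[ i < m ] g (h i)
  sum-map-tabulate zero    h = refl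
  sum-map-tabulate (suc m) h = cong (g (h zero) +_) (sum-map-tabulate m (h ∘ suc))

∑-mono-≤ : {f g : Fin n → ℕ} → (∀ i → f i ≤ g i) → sum f ≤ sum g
∑-mono-≤ {zero}  f≤g = z≤n
∑-mono-≤ {suc n} f≤g = +-mono-≤ (f≤g zero) (∑-mono-≤ (f≤g ∘ suc))

∑-mono-< : {f g : Fin n → ℕ} → (∀ i → f i ≤ g i) → ∀ j → f j < g j → sum f < sum g
∑-mono-< f≤g zero    fj<gj = +-mono-<-≤ fj<gj (∑-mono-≤ (f≤g ∘ suc))
∑-mono-< f≤g (suc j) fj<gj = +-mono-≤-< (f≤g zero) (∑-mono-< (f≤g ∘ suc) j fj<gj)

∑-term : (g : Fin n → ℕ) (i : Fin n) → g i ≤ sum g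
∑-term g zero    = m≤m+n (g zero) _
∑-term g (suc i) = ≤-trans (∑-term (g ∘ suc) i) (m≤n+m _ (g zero))

∑-δ : (b : Fin n) (g : Fin n → ℕ) → ∑[ v < n ] (⟦ does (v ≟ b) ⟧ * g v) ≡ g b
∑-δ {suc n} zero    g = begin
  g zero + 0 + ∑[ v < n ] 0 ≡⟨ cong₂ _+_ (+-identityʳ (g zero)) (sum-replicate-zero n) ⟩
  g zero + 0                ≡⟨ +-identityʳ (g zero) ⟩
  g zero                    ∎
  where open ≡-Reasoning
∑-δ {suc n} (suc b) g = ∑-δ b (g ∘ suc)

∑₂ : (Fin n → Fin n → ℕ) → ℕ
∑₂ {n} f = ∑[ u < n ] ∑[ w < n ] f u w

∑₂-distrib-+ : (f g : Fin n → Fin n → ℕ) → ∑₂ (λ u w → f u w + g u w) ≡ ∑₂ f + ∑₂ g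
∑₂-distrib-+ f g = trans (sum-cong-≗ λ u → ∑-distrib-+ (f u) (g u)) (∑-distrib-+ (λ u → sum (f u)) (λ u → sum (g u)))

∑₂-mono-≤ : {f g : Fin n → Fin n → ℕ} → (∀ u w → f u w ≤ g u w) → ∑₂ f ≤ ∑₂ g
∑₂-mono-≤ f≤g = ∑-mono-≤ λ u → ∑-mono-≤ (f≤g u)

∑₂-cong : {f g : Fin n → Fin n → ℕ} → (∀ u w → f u w ≡ g u w) → ∑₂ f ≡ ∑₂ g
∑₂-cong f≗g = sum-cong-≗ λ u → sum-cong-≗ (f≗g u)

∑₂-δ : (a b : Fin n) (g : Fin n → Fin n → ℕ) → ∑₂ (λ u w → ⟦ does (u ≟ a) ⟧ * (⟦ does (w ≟ b) ⟧ * g u w)) ≡ g a b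
∑₂-δ {n} a b g = begin
  ∑₂ (λ u w → ⟦ does (u ≟ a) ⟧ * (⟦ does (w ≟ b) ⟧ * g u w))
    ≡⟨ sum-cong-≗ (λ u → *-distribˡ-sum ⟦ does (u ≟ a) ⟧ (λ w → ⟦ does (w ≟ b) ⟧ * g u w)) ⟨
  ∑[ u < n ] (⟦ does (u ≟ a) ⟧ * ∑[ w < n ] (⟦ does (w ≟ b) ⟧ * g u w))
    ≡⟨ sum-cong-≗ (λ u → cong (⟦ does (u ≟ a) ⟧ *_) (∑-δ b (g u))) ⟩
  ∑[ u < n ] (⟦ does (u ≟ a) ⟧ * g u b)
    ≡⟨ ∑-δ a (λ u → g u b) ⟩
  g a b
    ∎
  where open ≡-Reasoning

⟦∧⟧≡* : ∀ x y → ⟦ x ∧ y ⟧ ≡ ⟦ x ⟧ * ⟦ y ⟧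
⟦∧⟧≡* true  y = sym (+-identityʳ ⟦ y ⟧)
⟦∧⟧≡* false y = refl

⟦∧⟧≤ˡ : ∀ x y → ⟦ x ∧ y ⟧ ≤ ⟦ x ⟧
⟦∧⟧≤ˡ true  true  = ≤-refl
⟦∧⟧≤ˡ true  false = z≤n
⟦∧⟧≤ˡ false y     = z≤n

⟦∧⟧≤ʳ : ∀ x y → ⟦ x ∧ y ⟧ ≤ ⟦ y ⟧
⟦∧⟧≤ʳ true  y = ≤-refl
⟦∧⟧≤ʳ false y = z≤n

⟦∨⟧+⟦∧⟧ : ∀ x y → ⟦ x ∨ y ⟧ + ⟦ x ∧ y ⟧ ≡ ⟦ x ⟧ + ⟦ y ⟧
⟦∨⟧+⟦∧⟧ true  true  = refl
⟦∨⟧+⟦∧⟧ true  false = refl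
⟦∨⟧+⟦∧⟧ false y     = +-identityʳ ⟦ y ⟧

⟦∧⟧-monoʳ : ∀ x {y z} → (y ≡ true → z ≡ true) → ⟦ x ∧ y ⟧ ≤ ⟦ x ∧ z ⟧
⟦∧⟧-monoʳ false       _  = z≤n
⟦∧⟧-monoʳ true {true} y⇒z rewrite y⇒z refl = ≤-refl
⟦∧⟧-monoʳ true {false} _ = z≤n

⟦⟧<⟦∨⟧ : ∀ x y → ⟦ x ⟧ < ⟦ x ∨ y ⟧ → x ≡ false × y ≡ true
⟦⟧<⟦∨⟧ true  _     (s≤s ())
⟦⟧<⟦∨⟧ false true  _ = refl , refl
⟦⟧<⟦∨⟧ false false ()

⟦⟧≤⟦∧⟧+⟦∧⟧ : ∀ ℓ ℓ′ b → (b ≡ true → (ℓ ∨ ℓ′) ≡ true) → ⟦ b ⟧ ≤ ⟦ ℓ ∧ b ⟧ + ⟦ ℓ′ ∧ b ⟧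
⟦⟧≤⟦∧⟧+⟦∧⟧ _     _     false _ = z≤n
⟦⟧≤⟦∧⟧+⟦∧⟧ true  _     true  _ = s≤s z≤n
⟦⟧≤⟦∧⟧+⟦∧⟧ false true  true  _ = ≤-refl
⟦⟧≤⟦∧⟧+⟦∧⟧ false false true  h = contradiction (h refl) λ ()

∨≡true : ∀ x y → (x ∨ y) ≡ true → x ≡ true ⊎ y ≡ true
∨≡true true  _ _ = inj₁ refl
∨≡true false _ e = inj₂ e

0<ᵇ⇒1≤ : ∀ {m} → (0 <ᵇ m) ≡ true → 1 ≤ m
0<ᵇ⇒1≤ {suc m} _ = s≤s z≤n

⟦0<ᵇ⟧*-identity : ∀ m → ⟦ 0 <ᵇ m ⟧ * m ≡ m
⟦0<ᵇ⟧*-identity zero    = refl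
⟦0<ᵇ⟧*-identity (suc m) = +-identityʳ (suc m)

Digraph : ℕ → Set
Digraph n = Fin n → Fin n → Bool

Asymmetric : Digraph n → Set
Asymmetric E = ∀ u w → E u w ≡ true → E w u ≡ false

arcsMeeting : Digraph n → (Fin n → Bool) → ℕ
arcsMeeting E X = ∑₂ λ u w → ⟦ E u w ∧ (X u ∨ X w) ⟧

demand : (Fin n → ℕ) → (Fin n → Bool) → ℕ
demand {n} c X = ∑[ v < n ] (⟦ X v ⟧ * c v)

indegree : Digraph n → Fin n → ℕ
indegree {n} t v = ∑[ w < n ] ⟦ t w v ⟧

HallCondition : Digraph n → (Fin n → ℕ) → Set
HallCondition E c = ∀ X → demand c X ≤ arcsMeeting E X

record Orientation (E : Digraph n) (c : Fin n → ℕ) : Set where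
  field
    arc             : Digraph n
    arc⇒edge        : ∀ u w → arc u w ≡ true → E u w ≡ true ⊎ E w u ≡ true
    arc-asymmetric  : Asymmetric arc
    demand≤indegree : ∀ v → c v ≤ indegree arc v

private variable
  E E′ : Digraph n
  c : Fin n → ℕ
  p q : Fin n

arcsMeeting-cong : (E : Digraph n) {X Y : Fin n → Bool} → (∀ u → X u ≡ Y u) → arcsMeeting E X ≡ arcsMeeting E Y
arcsMeeting-cong E X≗Y = ∑₂-cong λ u w → cong₂ (λ x y → ⟦ E u w ∧ (x ∨ y) ⟧) (X≗Y u) (X≗Y w)

demand-cong : (c : Fin n → ℕ) {X Y : Fin n → Bool} → (∀ u → X u ≡ Y u) → demand c X ≡ demand c Y
demand-cong c X≗Y = sum-cong-≗ λ v → cong (λ x → ⟦ x ⟧ * c v) (X≗Y v)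

HallCondition-fromSubsets : (∀ (S : Subset n) → demand c (lookup S) ≤ arcsMeeting E (lookup S)) → HallCondition E c
HallCondition-fromSubsets {c = c} {E = E} hall X =
  subst₂ _≤_ (demand-cong c (lookup∘tabulate X)) (arcsMeeting-cong E (lookup∘tabulate X)) (hall (tabulate X))

hall? : (E : Digraph n) (c : Fin n → ℕ) → HallCondition E c ⊎ ∃[ X ] arcsMeeting E X < demand c X
hall? E c with anySubset? (λ S → arcsMeeting E (lookup S) <? demand c (lookup S))
... | yes (S , deficient) = inj₂ (lookup S , deficient)
... | no none             = inj₁ (HallCondition-fromSubsets λ S → ≮⇒≥ λ deficient → none (S , deficient))

arcsMeeting-mono : (E : Digraph n) {X Y : Fin n → Bool} → (∀ u → X u ≡ true → Y u ≡ true) →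
  arcsMeeting E X ≤ arcsMeeting E Y
arcsMeeting-mono E X⊆Y = ∑₂-mono-≤ λ u w → meets-mono (E u w) (X⊆Y u) (X⊆Y w)
  where
  meets-mono : ∀ e {xu xw yu yw} → (xu ≡ true → yu ≡ true) → (xw ≡ true → yw ≡ true) →
    ⟦ e ∧ (xu ∨ xw) ⟧ ≤ ⟦ e ∧ (yu ∨ yw) ⟧
  meets-mono false                  _  _  = z≤n
  meets-mono true {true}            u⇒ _  rewrite u⇒ refl = ≤-refl
  meets-mono true {false} {true} {yu} _ w⇒ rewrite w⇒ refl | ∨-zeroʳ yu = ≤-refl
  meets-mono true {false} {false}   _  _  = z≤n

cover-submodular : ∀ xu yu xw yw →
  ⟦ (xu ∨ yu) ∨ (xw ∨ yw) ⟧ + ⟦ (xu ∧ yu) ∨ (xw ∧ yw) ⟧ ≤ ⟦ xu ∨ xw ⟧ + ⟦ yu ∨ yw ⟧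
cover-submodular true  true  xw yw = ≤-refl
cover-submodular true  false xw yw = s≤s (⟦∧⟧≤ʳ xw yw)
cover-submodular false true  xw yw = subst (suc ⟦ xw ∧ yw ⟧ ≤_) (+-comm 1 ⟦ xw ⟧) (s≤s (⟦∧⟧≤ˡ xw yw))
cover-submodular false false xw yw = ≤-reflexive (⟦∨⟧+⟦∧⟧ xw yw)

arcsMeeting-submodular : (E : Digraph n) (X Y : Fin n → Bool) →
  arcsMeeting E (λ u → X u ∨ Y u) + arcsMeeting E (λ u → X u ∧ Y u) ≤ arcsMeeting E X + arcsMeeting E Y
arcsMeeting-submodular {n} E X Y =
  subst₂ _≤_ (∑₂-distrib-+ {n} _ _) (∑₂-distrib-+ {n} _ _) (∑₂-mono-≤ λ u w → meets-submodular (E u w) (X u) (Y u) (X w) (Y w))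
  where
  meets-submodular : ∀ e xu yu xw yw →
    ⟦ e ∧ ((xu ∨ yu) ∨ (xw ∨ yw)) ⟧ + ⟦ e ∧ ((xu ∧ yu) ∨ (xw ∧ yw)) ⟧ ≤ ⟦ e ∧ (xu ∨ xw) ⟧ + ⟦ e ∧ (yu ∨ yw) ⟧
  meets-submodular false _  _  _  _  = z≤n
  meets-submodular true  xu yu xw yw = cover-submodular xu yu xw yw

demand-modular : (c : Fin n → ℕ) (X Y : Fin n → Bool) →
  demand c (λ u → X u ∨ Y u) + demand c (λ u → X u ∧ Y u) ≡ demand c X + demand c Y
demand-modular {n} c X Y = trans (sym (∑-distrib-+ {n} _ _)) (trans (sum-cong-≗ pointwise) (∑-distrib-+ {n} _ _))
  where
  pointwise : ∀ v → ⟦ X v ∨ Y v ⟧ * c v + ⟦ X v ∧ Y v ⟧ * c v ≡ ⟦ X v ⟧ * c v + ⟦ Y v ⟧ * c v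
  pointwise v = begin
    ⟦ X v ∨ Y v ⟧ * c v + ⟦ X v ∧ Y v ⟧ * c v ≡⟨ *-distribʳ-+ (c v) ⟦ X v ∨ Y v ⟧ _ ⟨
    (⟦ X v ∨ Y v ⟧ + ⟦ X v ∧ Y v ⟧) * c v     ≡⟨ cong (_* c v) (⟦∨⟧+⟦∧⟧ (X v) (Y v)) ⟩
    (⟦ X v ⟧ + ⟦ Y v ⟧) * c v                 ≡⟨ *-distribʳ-+ (c v) ⟦ X v ⟧ _ ⟩
    ⟦ X v ⟧ * c v + ⟦ Y v ⟧ * c v             ∎
    where open ≡-Reasoning

removeArc : Digraph n → Fin n → Fin n → Digraph n
removeArc E a b u w = not (does (u ≟ a) ∧ does (w ≟ b)) ∧ E u w

arcsMeeting-removeArc : {a b : Fin n} → E a b ≡ true →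
  ∀ X → arcsMeeting E X ≡ arcsMeeting (removeArc E a b) X + ⟦ X a ∨ X b ⟧
arcsMeeting-removeArc {n} {E} {a} {b} Eab X = begin
  arcsMeeting E X                                                  ≡⟨ ∑₂-cong split ⟩
  ∑₂ (λ u w → ⟦ removeArc E a b u w ∧ meets u w ⟧ + at-ab u w)     ≡⟨ ∑₂-distrib-+ _ at-ab ⟩
  arcsMeeting (removeArc E a b) X + ∑₂ at-ab                       ≡⟨ cong (arcsMeeting (removeArc E a b) X +_) (∑₂-δ a b _) ⟩
  arcsMeeting (removeArc E a b) X + ⟦ X a ∨ X b ⟧                  ∎
  where
  open ≡-Reasoning
  meets : Fin n → Fin n → Bool
  meets u w = X u ∨ X w
  at-ab : Fin n → Fin n → ℕ
  at-ab u w = ⟦ does (u ≟ a) ⟧ * (⟦ does (w ≟ b) ⟧ * ⟦ meets u w ⟧)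
  split : ∀ u w → ⟦ E u w ∧ meets u w ⟧ ≡ ⟦ removeArc E a b u w ∧ meets u w ⟧ + at-ab u w
  split u w with u ≟ a | w ≟ b
  ... | yes refl | yes refl rewrite Eab = sym (trans (*-identityˡ _) (*-identityˡ _))
  ... | yes refl | no _     = sym (+-identityʳ _)
  ... | no _     | _        = sym (+-identityʳ _)

record EdgeDeleted (E E′ : Digraph n) (p q : Fin n) : Set where
  field
    meeting   : ∀ X → arcsMeeting E X ≡ arcsMeeting E′ X + ⟦ X p ∨ X q ⟧
    distinct  : p ≢ q
    joined    : E p q ≡ true ⊎ E q p ≡ true
    deletedˡ  : E′ p q ≡ false
    deletedʳ  : E′ q p ≡ false
    ⊆-deleted : ∀ u w → E′ u w ≡ true → E u w ≡ true

swap : EdgeDeleted E E′ p q → EdgeDeleted E E′ q p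
swap {E′ = E′} {p} {q} d = record
  { meeting   = λ X → trans (meeting X) (cong (λ b → arcsMeeting E′ X + ⟦ b ⟧) (∨-comm (X p) (X q)))
  ; distinct  = distinct ∘ sym
  ; joined    = Sum.swap joined
  ; deletedˡ  = deletedʳ
  ; deletedʳ  = deletedˡ
  ; ⊆-deleted = ⊆-deleted
  }
  where open EdgeDeleted d

removeArc-deletes : Asymmetric E → {a b : Fin n} → E a b ≡ true → EdgeDeleted E (removeArc E a b) a b
removeArc-deletes {E = E} asym {a} {b} Eab = record
  { meeting   = arcsMeeting-removeArc Eab
  ; distinct  = λ { refl → contradiction (trans (sym Eab) (asym a a Eab)) λ () }
  ; joined    = inj₁ Eab
  ; deletedˡ  = deletedˡ
  ; deletedʳ  = trans (cong (not _ ∧_) (asym a b Eab)) (∧-zeroʳ _)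
  ; ⊆-deleted = λ u w → ∧-conicalʳ _ _
  }
  where
  deletedˡ : removeArc E a b a b ≡ false
  deletedˡ rewrite dec-true (a ≟ a) refl | dec-true (b ≟ b) refl = refl

lower : Fin n → (Fin n → ℕ) → Fin n → ℕ
lower p c v = c v ∸ ⟦ does (v ≟ p) ⟧

demand-lower : 1 ≤ c p → ∀ X → demand c X ≡ demand (lower p c) X + ⟦ X p ⟧
demand-lower {n} {c} {p} 1≤cp X =
  trans (sum-cong-≗ split) (trans (∑-distrib-+ {n} _ _) (cong (demand (lower p c) X +_) (∑-δ p (λ v → ⟦ X v ⟧))))
  where
  split : ∀ v → ⟦ X v ⟧ * c v ≡ ⟦ X v ⟧ * lower p c v + ⟦ does (v ≟ p) ⟧ * ⟦ X v ⟧
  split v with v ≟ p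
  ... | no _     = sym (+-identityʳ _)
  ... | yes refl = begin
    ⟦ X v ⟧ * c v                       ≡⟨ cong (⟦ X v ⟧ *_) (m∸n+n≡m 1≤cp) ⟨
    ⟦ X v ⟧ * (c v ∸ 1 + 1)             ≡⟨ *-distribˡ-+ ⟦ X v ⟧ (c v ∸ 1) 1 ⟩
    ⟦ X v ⟧ * (c v ∸ 1) + ⟦ X v ⟧ * 1   ≡⟨ cong (⟦ X v ⟧ * (c v ∸ 1) +_) (trans (*-identityʳ _) (sym (*-identityˡ _))) ⟩
    ⟦ X v ⟧ * (c v ∸ 1) + 1 * ⟦ X v ⟧   ∎
    where open ≡-Reasoning

module AddArc {E E′ : Digraph n} {p q : Fin n} {c : Fin n → ℕ}
  (d : EdgeDeleted E E′ p q) (o′ : Orientation E′ (lower p c)) where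

  open EdgeDeleted d
  module O′ = Orientation o′

  new : Digraph n
  new u w = does (u ≟ q) ∧ does (w ≟ p)

  arc⁺ : Digraph n
  arc⁺ u w = O′.arc u w ∨ new u w

  old-absent : ∀ {u w} → E′ u w ≡ false → E′ w u ≡ false → O′.arc u w ≡ false
  old-absent {u} {w} uw wu = ¬-not λ e →
    Sum.[ (λ x → contradiction (trans (sym x) uw) λ ()) , (λ x → contradiction (trans (sym x) wu) λ ()) ]
      (O′.arc⇒edge u w e)

  arc⁺⇒edge : ∀ u w → arc⁺ u w ≡ true → E u w ≡ true ⊎ E w u ≡ true
  arc⁺⇒edge u w h with O′.arc u w in old | u ≟ q | w ≟ p
  ... | true  | _        | _        = Sum.map (⊆-deleted u w) (⊆-deleted w u) (O′.arc⇒edge u w old)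
  ... | false | yes refl | yes refl = Sum.swap joined
  arc⁺⇒edge u w () | false | yes refl | no _
  arc⁺⇒edge u w () | false | no _     | _

  arc⁺-asymmetric : Asymmetric arc⁺
  arc⁺-asymmetric u w h with O′.arc u w in old
  ... | true with w ≟ q | u ≟ p
  ...   | yes refl | yes refl = contradiction (trans (sym old) (old-absent deletedˡ deletedʳ)) λ ()
  ...   | yes refl | no _     = trans (∨-identityʳ _) (O′.arc-asymmetric u w old)
  ...   | no _     | _        = trans (∨-identityʳ _) (O′.arc-asymmetric u w old)
  arc⁺-asymmetric u w h | false with u ≟ q | w ≟ p
  ... | yes refl | yes refl
    rewrite old-absent deletedˡ deletedʳ | dec-false (p ≟ q) distinct = refl
  arc⁺-asymmetric u w () | false | yes refl | no _
  arc⁺-asymmetric u w () | false | no _     | _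

  ⟦arc⁺⟧ : ∀ v w → ⟦ arc⁺ w v ⟧ ≡ ⟦ does (w ≟ q) ⟧ * ⟦ does (v ≟ p) ⟧ + ⟦ O′.arc w v ⟧
  ⟦arc⁺⟧ v w with w ≟ q | v ≟ p
  ... | yes refl | yes refl rewrite old-absent deletedʳ deletedˡ = refl
  ... | yes refl | no _     = cong ⟦_⟧ (∨-identityʳ _)
  ... | no _     | _        = cong ⟦_⟧ (∨-identityʳ _)

  indegree-arc⁺ : ∀ v → indegree arc⁺ v ≡ ⟦ does (v ≟ p) ⟧ + indegree O′.arc v
  indegree-arc⁺ v = trans (sum-cong-≗ (⟦arc⁺⟧ v))
    (trans (∑-distrib-+ {n} _ _) (cong (_+ indegree O′.arc v) (∑-δ q (λ _ → ⟦ does (v ≟ p) ⟧))))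

  demand≤indegree⁺ : ∀ v → c v ≤ indegree arc⁺ v
  demand≤indegree⁺ v = begin
    c v                                    ≤⟨ m≤n+m∸n (c v) ⟦ does (v ≟ p) ⟧ ⟩
    ⟦ does (v ≟ p) ⟧ + lower p c v         ≤⟨ +-monoʳ-≤ ⟦ does (v ≟ p) ⟧ (O′.demand≤indegree v) ⟩
    ⟦ does (v ≟ p) ⟧ + indegree O′.arc v   ≡⟨ indegree-arc⁺ v ⟨
    indegree arc⁺ v                        ∎
    where open ≤-Reasoning

orient-towards : EdgeDeleted E E′ p q → Orientation E′ (lower p c) → Orientation E c
orient-towards d o′ = record
  { arc             = arc⁺
  ; arc⇒edge        = arc⁺⇒edge
  ; arc-asymmetric  = arc⁺-asymmetric
  ; demand≤indegree = demand≤indegree⁺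
  }
  where open AddArc d o′

deficient-separates : HallCondition E c → EdgeDeleted E E′ p q → 1 ≤ c p → ∀ X →
  arcsMeeting E′ X < demand (lower p c) X → X p ≡ false × X q ≡ true × arcsMeeting E′ X < demand c X
deficient-separates {E = E} {c} {E′} {p} {q} hall d 1≤cp X deficient =
  Xp , Xq , <-≤-trans deficient (≤-trans (m≤m+n _ ⟦ X p ⟧) (≤-reflexive (sym (demand-lower 1≤cp X))))
  where
  open EdgeDeleted d
  open ≤-Reasoning
  separated : ⟦ X p ⟧ < ⟦ X p ∨ X q ⟧
  separated = +-cancelˡ-< (arcsMeeting E′ X) _ _ (begin-strict
    arcsMeeting E′ X + ⟦ X p ⟧           <⟨ +-monoˡ-< ⟦ X p ⟧ deficient ⟩
    demand (lower p c) X + ⟦ X p ⟧       ≡⟨ demand-lower 1≤cp X ⟨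
    demand c X                           ≤⟨ hall X ⟩
    arcsMeeting E X                      ≡⟨ meeting X ⟩
    arcsMeeting E′ X + ⟦ X p ∨ X q ⟧     ∎)
  Xp = proj₁ (⟦⟧<⟦∨⟧ (X p) (X q) separated)
  Xq = proj₂ (⟦⟧<⟦∨⟧ (X p) (X q) separated)

-- Dropping q from X loses no demand and can only lose arcs.
no-deficiency-at-zero : HallCondition E c → EdgeDeleted E E′ p q → c q ≡ 0 → ∀ X →
  X p ≡ false → X q ≡ true → ¬ (arcsMeeting E′ X < demand c X)
no-deficiency-at-zero {n} {E} {c} {E′} {p} {q} hall d cq≡0 X Xp Xq deficient = <⇒≱ deficient (begin
  demand c X                                ≤⟨ ∑-mono-≤ drop-q ⟩
  demand c X′                               ≤⟨ hall X′ ⟩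
  arcsMeeting E X′                          ≡⟨ meeting X′ ⟩
  arcsMeeting E′ X′ + ⟦ X′ p ∨ X′ q ⟧       ≡⟨ cong (λ b → arcsMeeting E′ X′ + ⟦ b ⟧) avoids ⟩
  arcsMeeting E′ X′ + 0                     ≡⟨ +-identityʳ _ ⟩
  arcsMeeting E′ X′                         ≤⟨ arcsMeeting-mono E′ {X′} {X} (λ u → ∧-conicalʳ _ _) ⟩
  arcsMeeting E′ X                          ∎)
  where
  open EdgeDeleted d
  open ≤-Reasoning
  X′ : Fin n → Bool
  X′ u = not (does (u ≟ q)) ∧ X u
  drop-q : ∀ u → ⟦ X u ⟧ * c u ≤ ⟦ X′ u ⟧ * c u
  drop-q u with u ≟ q
  ... | yes refl rewrite cq≡0 = ≤-reflexive (*-zeroʳ ⟦ X u ⟧)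
  ... | no _     = ≤-refl
  avoids : (X′ p ∨ X′ q) ≡ false
  avoids rewrite dec-false (p ≟ q) distinct | dec-true (q ≟ q) refl | Xp = refl

-- X ∪ Y meets the deleted edge and X ∩ Y does not, so by submodularity the two deficiencies
-- add up to a violation of the Hall condition for E.
no-opposite-deficiencies : HallCondition E c → EdgeDeleted E E′ p q → ∀ X Y →
  X p ≡ false → X q ≡ true → arcsMeeting E′ X < demand c X →
  Y q ≡ false → Y p ≡ true → arcsMeeting E′ Y < demand c Y → ⊥
no-opposite-deficiencies {n} {E} {c} {E′} {p} {q} hall d X Y Xp Xq defX Yq Yp defY =
  <⇒≱ (≤-trans (s≤s (≤-reflexive (sym (+-suc _ _)))) (+-mono-≤ defX defY)) (begin
    demand c X + demand c Y                                     ≡⟨ demand-modular c X Y ⟨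
    demand c U + demand c N                                     ≤⟨ +-mono-≤ (hall U) (hall N) ⟩
    arcsMeeting E U + arcsMeeting E N                           ≡⟨ cong₂ _+_ (meeting U) (meeting N) ⟩
    (arcsMeeting E′ U + ⟦ U p ∨ U q ⟧) + (arcsMeeting E′ N + ⟦ N p ∨ N q ⟧)
      ≡⟨ cong₂ (λ b b′ → (arcsMeeting E′ U + ⟦ b ⟧) + (arcsMeeting E′ N + ⟦ b′ ⟧)) U-meets N-avoids ⟩
    (arcsMeeting E′ U + 1) + (arcsMeeting E′ N + 0)             ≡⟨ cong₂ _+_ (+-comm (arcsMeeting E′ U) 1) (+-identityʳ (arcsMeeting E′ N)) ⟩
    suc (arcsMeeting E′ U + arcsMeeting E′ N)                   ≤⟨ s≤s (arcsMeeting-submodular E′ X Y) ⟩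
    suc (arcsMeeting E′ X + arcsMeeting E′ Y)                   ∎)
  where
  open EdgeDeleted d
  open ≤-Reasoning
  U N : Fin n → Bool
  U u = X u ∨ Y u
  N u = X u ∧ Y u
  U-meets : (U p ∨ U q) ≡ true
  U-meets rewrite Xq = ∨-zeroʳ _
  N-avoids : (N p ∨ N q) ≡ false
  N-avoids rewrite Xp | Xq | Yq = refl

charge : HallCondition E c → EdgeDeleted E E′ p q → 1 ≤ c p →
  HallCondition E′ (lower p c) ⊎ HallCondition E′ (lower q c)
charge {c = c} {E′ = E′} {p} {q} hall d 1≤cp with hall? E′ (lower p c)
... | inj₁ hall′ = inj₁ hall′
... | inj₂ (X , defX) with deficient-separates hall d 1≤cp X defX | c q in cq
...   | Xp , Xq , defX′ | zero  = ⊥-elim (no-deficiency-at-zero hall d cq X Xp Xq defX′)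
...   | Xp , Xq , defX′ | suc _ with hall? E′ (lower q c)
...     | inj₁ hall′ = inj₂ hall′
...     | inj₂ (Y , defY) with deficient-separates hall (swap d) (subst (1 ≤_) (sym cq) (s≤s z≤n)) Y defY
...       | Yq , Yp , defY′ = ⊥-elim (no-opposite-deficiencies hall d X Y Xp Xq defX′ Yq Yp defY′)

orient-across : HallCondition E c → EdgeDeleted E E′ p q → 1 ≤ c p →
  (∀ c′ → HallCondition E′ c′ → Orientation E′ c′) → Orientation E c
orient-across hall d 1≤cp orient′ with charge hall d 1≤cp
... | inj₁ hall′ = orient-towards d (orient′ _ hall′)
... | inj₂ hall′ = orient-towards (swap d) (orient′ _ hall′)

support : (Fin n → ℕ) → Fin n → Bool
support c v = 0 <ᵇ c v

-- The Hall condition for the support of c forces c = 0.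
orient-isolated-support : HallCondition E c → (∀ a b → (E a b ∧ (support c a ∨ support c b)) ≡ false) → Orientation E c
orient-isolated-support {n} {E} {c} hall isolated = record
  { arc             = λ _ _ → false
  ; arc⇒edge        = λ _ _ ()
  ; arc-asymmetric  = λ _ _ ()
  ; demand≤indegree = λ v → begin
      c v                                 ≡⟨ ⟦0<ᵇ⟧*-identity (c v) ⟨
      ⟦ support c v ⟧ * c v               ≤⟨ ∑-term (λ u → ⟦ support c u ⟧ * c u) v ⟩
      demand c (support c)                ≤⟨ hall (support c) ⟩
      arcsMeeting E (support c)           ≡⟨ no-arc-meets ⟩
      0                                   ≡⟨ sum-replicate-zero n ⟨
      indegree (λ _ _ → false) v          ∎
  }
  where
  open ≤-Reasoning
  no-arc-meets : arcsMeeting E (support c) ≡ 0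
  no-arc-meets = trans (sum-cong-≗ λ u → trans (sum-cong-≗ λ w → cong ⟦_⟧ (isolated u w)) (sum-replicate-zero n))
                       (sum-replicate-zero n)

orient-demanding : HallCondition E c → EdgeDeleted E E′ p q → (support c p ∨ support c q) ≡ true →
  (∀ c′ → HallCondition E′ c′ → Orientation E′ c′) → Orientation E c
orient-demanding {c = c} {p = p} hall d demanding orient′ with support c p in p-demands
... | true  = orient-across hall d (0<ᵇ⇒1≤ p-demands) orient′
... | false = orient-across hall (swap d) (0<ᵇ⇒1≤ demanding) orient′

removeArc-asymmetric : Asymmetric E → {a b : Fin n} → Asymmetric (removeArc E a b)
removeArc-asymmetric asym u w e = trans (cong (not _ ∧_) (asym u w (∧-conicalʳ _ _ e))) (∧-zeroʳ _)

find-pair : (h : Fin n → Fin n → Bool) → (∃₂ λ a b → h a b ≡ true) ⊎ (∀ a b → h a b ≡ false)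
find-pair h with any? (λ a → any? (λ b → h a b Bool.≟ true))
... | yes (a , b , hab) = inj₁ (a , b , hab)
... | no none           = inj₂ λ a b → ¬-not λ hab → none (a , b , hab)

orientation : ∀ k (E : Digraph n) → Asymmetric E → arcsMeeting E (λ _ → true) < k →
  ∀ c → HallCondition E c → Orientation E c
orientation (suc k) E asym bound c hall with find-pair (λ a b → E a b ∧ (support c a ∨ support c b))
... | inj₂ isolated        = orient-isolated-support hall isolated
... | inj₁ (a , b , found) = orient-demanding hall d (∧-conicalʳ _ _ found) λ c′ →
  orientation k (removeArc E a b) (removeArc-asymmetric asym) fewer-arcs c′
  where
  d = removeArc-deletes asym (∧-conicalˡ _ _ found)
  fewer-arcs : arcsMeeting (removeArc E a b) (λ _ → true) < k
  fewer-arcs = ≤-pred (subst (_< suc k) (trans (EdgeDeleted.meeting d (λ _ → true)) (+-comm _ 1)) bound)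

hakimi : Asymmetric E → HallCondition E c → Orientation E c
hakimi {E = E} {c = c} asym = orientation _ E asym (n<1+n _) c

ascendingEdges : Graph n → Subset n → Digraph n
ascendingEdges G A u w = (toℕ u <ᵇ toℕ w) ∧ AdjA G A u w

ascendingEdges-asymmetric : (G : Graph n) (A : Subset n) → Asymmetric (ascendingEdges G A)
ascendingEdges-asymmetric G A u w e with toℕ w <ᵇ toℕ u in w<u
... | false = refl
... | true  = contradiction (<ᵇ⇒< (toℕ w) (toℕ u) (T-from w<u))
                (<-asym (<ᵇ⇒< (toℕ u) (toℕ w) (T-from (∧-conicalˡ (toℕ u <ᵇ toℕ w) _ e))))
  where
  T-from : ∀ {x} → x ≡ true → Bool.T x
  T-from = Equivalence.from T-≡

ascendingEdges⇒adj : (G : Graph n) (A : Subset n) {u w : Fin n} → ascendingEdges G A u w ≡ true → Adj G u w ≡ true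
ascendingEdges⇒adj G A {u} {w} e = ∧-conicalˡ (Adj G u w) _ (∧-conicalʳ (toℕ u <ᵇ toℕ w) _ e)

ascendingEdges⇒meets : (G : Graph n) (A : Subset n) {u w : Fin n} → ascendingEdges G A u w ≡ true → u ∈ A ⊎ w ∈ A
ascendingEdges⇒meets G A {u} {w} e =
  Sum.map (lookup⇒[]= u A) (lookup⇒[]= w A) (∨≡true _ _ (∧-conicalʳ (Adj G u w) _ (∧-conicalʳ (toℕ u <ᵇ toℕ w) _ e)))

AdjA-sym : (G : Graph n) (A : Subset n) (u w : Fin n) → AdjA G A u w ≡ AdjA G A w u
AdjA-sym G A u w = cong₂ _∧_ (adj-sym G u w) (∨-comm (lookup A u) (lookup A w))

adjacent-comparable : (G : Graph n) {u w : Fin n} → Adj G u w ≡ true → ((toℕ u <ᵇ toℕ w) ∨ (toℕ w <ᵇ toℕ u)) ≡ true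
adjacent-comparable G {u} {w} adj with <-cmp (toℕ u) (toℕ w)
... | tri< u<w _ _ rewrite Equivalence.to T-≡ (<⇒<ᵇ u<w) = refl
... | tri> _ _ w<u rewrite Equivalence.to T-≡ (<⇒<ᵇ w<u) = ∨-zeroʳ _
... | tri≈ _ u≡w _ with toℕ-injective u≡w
...   | refl = contradiction (trans (sym adj) (irrefl G u)) λ ()

edge-classes : ∀ ℓ xu xw e →
  ⟦ ℓ ∧ xu ∧ xw ∧ e ⟧ + (⟦ ℓ ∧ xu ∧ not xw ∧ e ⟧ + ⟦ ℓ ∧ xw ∧ not xu ∧ e ⟧) ≡ ⟦ (ℓ ∧ e) ∧ (xu ∨ xw) ⟧
edge-classes false _     _     _     = refl
edge-classes true  true  true  true  = refl
edge-classes true  true  true  false = refl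
edge-classes true  true  false true  = refl
edge-classes true  true  false false = refl
edge-classes true  false true  true  = refl
edge-classes true  false true  false = refl
edge-classes true  false false true  = refl
edge-classes true  false false false = refl

module EdgeClasses (G : Graph n) (A X : Subset n) where

  x : Fin n → Bool
  x = lookup X

  e : Digraph n
  e = AdjA G A

  ℓ : Fin n → Fin n → Bool
  ℓ u w = toℕ u <ᵇ toℕ w

  inside leaving entering crossing : Fin n → Fin n → ℕ
  inside   u w = ⟦ ℓ u w ∧ x u ∧ x w ∧ e u w ⟧
  leaving  u w = ⟦ ℓ u w ∧ x u ∧ not (x w) ∧ e u w ⟧
  entering u w = ⟦ ℓ u w ∧ x w ∧ not (x u) ∧ e u w ⟧
  crossing u w = ⟦ x u ∧ not (x w) ∧ e u w ⟧

  edgesIn-as-∑₂ : edgesIn G A X ≡ ∑₂ inside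
  edgesIn-as-∑₂ = trans (Σᵥ≡∑ λ u → Σᵥ (inside u)) (sum-cong-≗ λ u → Σᵥ≡∑ (inside u))

  crossEdges-as-∑₂ : crossEdges G A X ≡ ∑₂ crossing
  crossEdges-as-∑₂ = trans (Σᵥ≡∑ λ u → ⟦ x u ⟧ * Σᵥ (λ w → ⟦ not (x w) ∧ e u w ⟧)) (sum-cong-≗ λ u → begin
    ⟦ x u ⟧ * Σᵥ (λ w → ⟦ not (x w) ∧ e u w ⟧)     ≡⟨ cong (⟦ x u ⟧ *_) (Σᵥ≡∑ λ w → ⟦ not (x w) ∧ e u w ⟧) ⟩
    ⟦ x u ⟧ * ∑[ w < _ ] ⟦ not (x w) ∧ e u w ⟧     ≡⟨ *-distribˡ-sum ⟦ x u ⟧ (λ w → ⟦ not (x w) ∧ e u w ⟧) ⟩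
    ∑[ w < _ ] (⟦ x u ⟧ * ⟦ not (x w) ∧ e u w ⟧)   ≡⟨ sum-cong-≗ (λ w → ⟦∧⟧≡* (x u) (not (x w) ∧ e u w)) ⟨
    ∑[ w < _ ] crossing u w                        ∎)
    where open ≡-Reasoning

  crossing-comparable : ∀ u w → (x u ∧ not (x w) ∧ e u w) ≡ true → (ℓ u w ∨ ℓ w u) ≡ true
  crossing-comparable u w h =
    adjacent-comparable G (∧-conicalˡ (Adj G u w) _ (∧-conicalʳ (not (x w)) _ (∧-conicalʳ (x u) _ h)))

  crossing≤leaving+entering : ∑₂ crossing ≤ ∑₂ leaving + ∑₂ entering
  crossing≤leaving+entering = begin
    ∑₂ crossing                               ≤⟨ ∑₂-mono-≤ (λ u w → ⟦⟧≤⟦∧⟧+⟦∧⟧ (ℓ u w) (ℓ w u) _ (crossing-comparable u w)) ⟩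
    ∑₂ (λ u w → leaving u w + backwards u w)  ≡⟨ ∑₂-distrib-+ leaving backwards ⟩
    ∑₂ leaving + ∑₂ backwards                 ≡⟨ cong (∑₂ leaving +_) backwards≡entering ⟩
    ∑₂ leaving + ∑₂ entering                  ∎
    where
    open ≤-Reasoning
    backwards : Fin n → Fin n → ℕ
    backwards u w = ⟦ ℓ w u ∧ x u ∧ not (x w) ∧ e u w ⟧
    backwards≡entering : ∑₂ backwards ≡ ∑₂ entering
    backwards≡entering = trans (∑-comm backwards)
      (∑₂-cong λ u w → cong (λ b → ⟦ ℓ u w ∧ x w ∧ not (x u) ∧ b ⟧) (AdjA-sym G A w u))

  classes-cover : ∑₂ inside + (∑₂ leaving + ∑₂ entering) ≡ arcsMeeting (ascendingEdges G A) x
  classes-cover = begin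
    ∑₂ inside + (∑₂ leaving + ∑₂ entering)               ≡⟨ cong (∑₂ inside +_) (∑₂-distrib-+ leaving entering) ⟨
    ∑₂ inside + ∑₂ (λ u w → leaving u w + entering u w)  ≡⟨ ∑₂-distrib-+ inside _ ⟨
    ∑₂ (λ u w → inside u w + (leaving u w + entering u w)) ≡⟨ ∑₂-cong (λ u w → edge-classes (ℓ u w) (x u) (x w) (e u w)) ⟩
    arcsMeeting (ascendingEdges G A) x                   ∎
    where open ≡-Reasoning

edgesIn+crossEdges≤arcsMeeting : (G : Graph n) (A X : Subset n) →
  edgesIn G A X + crossEdges G A X ≤ arcsMeeting (ascendingEdges G A) (lookup X)
edgesIn+crossEdges≤arcsMeeting G A X = begin
  edgesIn G A X + crossEdges G A X          ≡⟨ cong₂ _+_ edgesIn-as-∑₂ crossEdges-as-∑₂ ⟩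
  ∑₂ inside + ∑₂ crossing                   ≤⟨ +-monoʳ-≤ (∑₂ inside) crossing≤leaving+entering ⟩
  ∑₂ inside + (∑₂ leaving + ∑₂ entering)    ≡⟨ classes-cover ⟩
  arcsMeeting (ascendingEdges G A) x        ∎
  where
  open ≤-Reasoning
  open EdgeClasses G A X

lookup-─ : (p q : Subset n) (x : Fin n) → lookup (p ─ q) x ≡ lookup p x ∧ not (lookup q x)
lookup-─ (s ∷ p) (true  ∷ q) zero    = sym (∧-zeroʳ s)
lookup-─ (s ∷ p) (false ∷ q) zero    = sym (∧-identityʳ s)
lookup-─ (_ ∷ p) (_ ∷ q)     (suc x) = lookup-─ p q x

∉⇒lookup≡false : {p : Subset n} {x : Fin n} → x ∉ p → lookup p x ≡ false
∉⇒lookup≡false {p = p} {x} x∉p = ¬-not λ e → x∉p (lookup⇒[]= x p e)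

x∈p─q⇒x∉q : (p q : Subset n) {x : Fin n} → x ∈ p ─ q → x ∉ q
x∈p─q⇒x∉q p q {x} x∈p─q x∈q =
  contradiction (subst (λ b → not b ≡ true) ([]=⇒lookup x∈q) (∧-conicalʳ (lookup p x) _ (trans (sym (lookup-─ p q x)) ([]=⇒lookup x∈p─q)))) λ ()

count : Subset n → (Fin n → Bool) → ℕ
count {n} W P = ∑[ w < n ] ⟦ lookup W w ∧ P w ⟧

count-⊤ : (P : Fin n → Bool) → count ⊤ P ≡ ∑[ w < n ] ⟦ P w ⟧
count-⊤ P = sum-cong-≗ λ w → cong (λ b → ⟦ b ∧ P w ⟧) (lookup-replicate w true)

count-─∩ : (W I : Subset n) (P : Fin n → Bool) → count W P ≡ count (W ─ I) P + count (W ∩ I) P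
count-─∩ {n} W I P = trans (sum-cong-≗ pointwise) (∑-distrib-+ {n} _ _)
  where
  pointwise : ∀ w → ⟦ lookup W w ∧ P w ⟧ ≡ ⟦ lookup (W ─ I) w ∧ P w ⟧ + ⟦ lookup (W ∩ I) w ∧ P w ⟧
  pointwise w rewrite lookup-─ W I w | lookup-zipWith _∧_ w W I with lookup W w | lookup I w
  ... | false | _     = refl
  ... | true  | true  = refl
  ... | true  | false = sym (+-identityʳ _)

count-mono : (W : Subset n) {P Q : Fin n → Bool} → (∀ w → P w ≡ true → Q w ≡ true) → count W P ≤ count W Q
count-mono W P⇒Q = ∑-mono-≤ λ w → ⟦∧⟧-monoʳ (lookup W w) (P⇒Q w)

count-mono-< : (W : Subset n) {P Q : Fin n → Bool} → (∀ w → P w ≡ true → Q w ≡ true) →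
  ∀ {u} → u ∈ W → P u ≡ false → Q u ≡ true → count W P < count W Q
count-mono-< W {P} {Q} P⇒Q {u} u∈W Pu Qu = ∑-mono-< (λ w → ⟦∧⟧-monoʳ (lookup W w) (P⇒Q w)) u strict
  where
  strict : ⟦ lookup W u ∧ P u ⟧ < ⟦ lookup W u ∧ Q u ⟧
  strict rewrite []=⇒lookup u∈W | Pu | Qu = s≤s z≤n

reduce-as-∸ : (S I : Subset n) (f : Fin n → ℕ) (v : Fin n) → reduce S I f v ≡ f v ∸ ⟦ lookup S v ∧ not (lookup I v) ⟧
reduce-as-∸ S I f v with lookup S v ∧ not (lookup I v)
... | true  = refl
... | false = refl

m+n<o+p⇒m<o∸n+p : ∀ d k f i → d + k < f + i → d < f ∸ k + i
m+n<o+p⇒m<o∸n+p d zero    f       i h = subst (_< f + i) (+-identityʳ d) h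
m+n<o+p⇒m<o∸n+p d (suc k) zero    i h = ≤-trans (s≤s (m≤m+n d (suc k))) h
m+n<o+p⇒m<o∸n+p d (suc k) (suc f) i h = m+n<o+p⇒m<o∸n+p d k f i (≤-pred (subst (λ x → suc x ≤ suc f + i) (+-suc d k) h))

slack-transfer : ∀ d′ dI f i′ iI k → d′ + dI < f + (i′ + iI) → iI + k ≤ dI → d′ < f ∸ k + i′
slack-transfer d′ dI f i′ iI k slack gap = m+n<o+p⇒m<o∸n+p d′ k f i′ (+-cancelʳ-< iI (d′ + k) (f + i′) (begin-strict
  d′ + k + iI     ≡⟨ +-assoc d′ k iI ⟩
  d′ + (k + iI)   ≡⟨ cong (d′ +_) (+-comm k iI) ⟩
  d′ + (iI + k)   ≤⟨ +-monoʳ-≤ d′ gap ⟩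
  d′ + dI         <⟨ slack ⟩
  f + (i′ + iI)   ≡⟨ +-assoc f i′ iI ⟨
  f + i′ + iI     ∎))
  where open ≤-Reasoning

weight : Subset n → (Fin n → ℕ) → ℕ
weight {n} W f = ∑[ v < n ] (⟦ lookup W v ⟧ * suc (f v))

weight-decreases : ∀ {W S I : Subset n} {f s} → s ∈ S → S ⊆ W → 1 ≤ f s → weight (W ─ I) (reduce S I f) < weight W f
weight-decreases {W = W} {S} {I} {f} {s} s∈S S⊆W 1≤fs = ∑-mono-< shrinks s strict
  where
  shrinks : ∀ v → ⟦ lookup (W ─ I) v ⟧ * suc (reduce S I f v) ≤ ⟦ lookup W v ⟧ * suc (f v)
  shrinks v rewrite lookup-─ W I v | reduce-as-∸ S I f v with lookup W v | lookup I v
  ... | false | _     = z≤n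
  ... | true  | true  = z≤n
  ... | true  | false = *-monoʳ-≤ 1 (s≤s (m∸n≤m (f v) ⟦ lookup S v ∧ not false ⟧))
  strict : ⟦ lookup (W ─ I) s ⟧ * suc (reduce S I f s) < ⟦ lookup W s ⟧ * suc (f s)
  strict rewrite lookup-─ W I s | reduce-as-∸ S I f s | []=⇒lookup (S⊆W s∈S) | []=⇒lookup s∈S with lookup I s
  ... | true  = s≤s z≤n
  ... | false = *-monoʳ-< 1 (s≤s (∸-monoʳ-< (s≤s z≤n) 1≤fs))

module OnlineFromOrientation
  (G : Graph n) (A : Subset n) (A-independent : Independent G A) (t : Digraph n)
  (arc⇒adj : ∀ u w → t u w ≡ true → Adj G u w ≡ true)
  (arc-meets-A : ∀ u w → t u w ≡ true → u ∈ A ⊎ w ∈ A)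
  (t-asymmetric : Asymmetric t)
  where

  record Kernel (S : Subset n) : Set where
    field
      I           : Subset n
      I⊆S         : I ⊆ S
      independent : Independent G I
      absorbing   : ∀ {v} → v ∈ S → v ∉ I → ∃[ u ] u ∈ I × Adj G v u ≡ true × t u v ≡ false

  Blocked : Subset n → Fin n → Set
  Blocked S b = ∃[ u ] u ∈ S × u ∈ A × t b u ≡ true

  blocked? : (S : Subset n) → Decidable (Blocked S)
  blocked? S b = any? λ u → u ∈? S ×-dec u ∈? A ×-dec t b u Bool.≟ true

  kernel-of-blocked : (S : Subset n) → (∀ {b} → b ∈ S → b ∉ A → Blocked S b) → Kernel S
  kernel-of-blocked S blocked = record
    { I           = S ∩ A
    ; I⊆S         = p∩q⊆p S A
    ; independent = λ u w u∈ w∈ → A-independent u w (proj₂ (x∈p∩q⁻ S A u∈)) (proj₂ (x∈p∩q⁻ S A w∈))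
    ; absorbing   = absorbing
    }
    where
    absorbing : ∀ {v} → v ∈ S → v ∉ S ∩ A → ∃[ u ] u ∈ S ∩ A × Adj G v u ≡ true × t u v ≡ false
    absorbing {v} v∈S v∉I with blocked v∈S (λ v∈A → v∉I (x∈p∩q⁺ (v∈S , v∈A)))
    ... | u , u∈S , u∈A , tvu = u , x∈p∩q⁺ (u∈S , u∈A) , arc⇒adj v u tvu , t-asymmetric v u tvu

  neighbours : Fin n → Subset n
  neighbours b = tabulate (Adj G b)

  ∈neighbours⇒adj : ∀ {b v} → v ∈ neighbours b → Adj G b v ≡ true
  ∈neighbours⇒adj {b} {v} v∈N = trans (sym (lookup∘tabulate (Adj G b) v)) ([]=⇒lookup v∈N)

  adj⇒∈neighbours : ∀ {b v} → Adj G b v ≡ true → v ∈ neighbours b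
  adj⇒∈neighbours {b} {v} adj = lookup⇒[]= v (neighbours b) (trans (lookup∘tabulate (Adj G b) v) adj)

  extend-kernel : ∀ {S b} → b ∈ S → b ∉ A → ¬ Blocked S b → Kernel (S ─ (⁅ b ⁆ ∪ neighbours b)) → Kernel S
  extend-kernel {S} {b} b∈S b∉A unblocked K′ = record
    { I           = I′ ∪ ⁅ b ⁆
    ; I⊆S         = I⊆S
    ; independent = independent
    ; absorbing   = absorbing
    }
    where
    open Kernel K′ renaming (I to I′; I⊆S to I′⊆S′; independent to I′-independent; absorbing to I′-absorbing)
    closed : Subset n
    closed = ⁅ b ⁆ ∪ neighbours b

    far : ∀ {u} → u ∈ S ─ closed → Adj G b u ≡ false
    far u∈S′ = ¬-not λ adj → x∈p─q⇒x∉q S closed u∈S′ (x∈p∪q⁺ (inj₂ (adj⇒∈neighbours adj)))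

    I⊆S : I′ ∪ ⁅ b ⁆ ⊆ S
    I⊆S x∈I with x∈p∪q⁻ I′ ⁅ b ⁆ x∈I
    ... | inj₁ x∈I′ = p─q⊆p S closed (I′⊆S′ x∈I′)
    ... | inj₂ x∈b  = subst (_∈ S) (sym (x∈⁅y⁆⇒x≡y b x∈b)) b∈S

    independent : Independent G (I′ ∪ ⁅ b ⁆)
    independent u w u∈I w∈I with x∈p∪q⁻ I′ ⁅ b ⁆ u∈I | x∈p∪q⁻ I′ ⁅ b ⁆ w∈I
    ... | inj₁ u∈I′ | inj₁ w∈I′ = I′-independent u w u∈I′ w∈I′
    ... | inj₁ u∈I′ | inj₂ w∈b rewrite x∈⁅y⁆⇒x≡y b w∈b = trans (adj-sym G u b) (far (I′⊆S′ u∈I′))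
    ... | inj₂ u∈b  | inj₁ w∈I′ rewrite x∈⁅y⁆⇒x≡y b u∈b = far (I′⊆S′ w∈I′)
    ... | inj₂ u∈b  | inj₂ w∈b rewrite x∈⁅y⁆⇒x≡y b u∈b | x∈⁅y⁆⇒x≡y b w∈b = irrefl G b

    absorbing : ∀ {v} → v ∈ S → v ∉ I′ ∪ ⁅ b ⁆ → ∃[ u ] u ∈ I′ ∪ ⁅ b ⁆ × Adj G v u ≡ true × t u v ≡ false
    absorbing {v} v∈S v∉I with v ∈? neighbours b
    ... | yes v∈N = b , x∈p∪q⁺ (inj₂ (x∈⁅x⁆ b)) , trans (adj-sym G v b) (∈neighbours⇒adj v∈N) ,
                    ¬-not λ tbv → Sum.[ b∉A , (λ v∈A → unblocked (v , v∈S , v∈A , tbv)) ] (arc-meets-A b v tbv)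
    ... | no v∉N with I′-absorbing (x∈p∧x∉q⇒x∈p─q v∈S v∉closed) (v∉I ∘ x∈p∪q⁺ ∘ inj₁)
      where
      v∉closed : v ∉ closed
      v∉closed v∈closed = Sum.[ v∉I ∘ x∈p∪q⁺ ∘ inj₂ , v∉N ] (x∈p∪q⁻ ⁅ b ⁆ (neighbours b) v∈closed)
    ...   | u , u∈I′ , adj , tuv = u , x∈p∪q⁺ (inj₁ u∈I′) , adj , tuv

  kernel : ∀ k (S : Subset n) → ∣ S ∣ < k → Kernel S
  kernel (suc k) S bound with any? (λ b → b ∈? S ×-dec ¬? (b ∈? A) ×-dec ¬? (blocked? S b))
  ... | yes (b , b∈S , b∉A , unblocked) = extend-kernel b∈S b∉A unblocked (kernel k _ smaller)
    where
    smaller : ∣ S ─ (⁅ b ⁆ ∪ neighbours b) ∣ < k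
    smaller = <-≤-trans (p∩q≢∅⇒∣p─q∣<∣p∣ S _ (b , x∈p∩q⁺ (b∈S , x∈p∪q⁺ (inj₁ (x∈⁅x⁆ b))))) (≤-pred bound)
  ... | no none = kernel-of-blocked S λ {b} b∈S b∉A →
    decidable-stable (blocked? S b) λ unblocked → none (b , b∈S , b∉A , unblocked)

  degreeIn indegreeIn : Subset n → Fin n → ℕ
  degreeIn   W v = count W (Adj G v)
  indegreeIn W v = count W (λ w → t w v)

  in-arc⇒adj : ∀ v w → t w v ≡ true → Adj G v w ≡ true
  in-arc⇒adj v w e = trans (adj-sym G v w) (arc⇒adj w v e)

  indegreeIn≤degreeIn : ∀ W v → indegreeIn W v ≤ degreeIn W v
  indegreeIn≤degreeIn W v = count-mono W (in-arc⇒adj v)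

  Slack : Subset n → (Fin n → ℕ) → Set
  Slack W f = ∀ {v} → v ∈ W → degreeIn W v < f v + indegreeIn W v

  slack⇒positive : ∀ W f → Slack W f → ∀ {v} → v ∈ W → 1 ≤ f v
  slack⇒positive W f slack {v} v∈W =
    +-cancelʳ-< (indegreeIn W v) 0 (f v) (≤-<-trans (indegreeIn≤degreeIn W v) (slack v∈W))

  module _ {W S : Subset n} (S⊆W : S ⊆ W) (K : Kernel S) where

    open Kernel K

    kernel-gap : ∀ {v} → v ∉ I → indegreeIn (W ∩ I) v + ⟦ lookup S v ∧ not (lookup I v) ⟧ ≤ degreeIn (W ∩ I) v
    kernel-gap {v} v∉I with lookup S v in Sv
    ... | false = subst (_≤ degreeIn (W ∩ I) v) (sym (+-identityʳ _)) (indegreeIn≤degreeIn (W ∩ I) v)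
    ... | true with absorbing (lookup⇒[]= v S Sv) v∉I
    ...   | u , u∈I , adj , tuv rewrite ∉⇒lookup≡false v∉I =
      subst (_≤ degreeIn (W ∩ I) v) (+-comm 1 _)
        (count-mono-< (W ∩ I) (in-arc⇒adj v) (x∈p∩q⁺ (S⊆W (I⊆S u∈I) , u∈I)) tuv adj)

    slack-preserved : ∀ {f} → Slack W f → Slack (W ─ I) (reduce S I f)
    slack-preserved {f} slack {v} v∈W─I = begin-strict
      degreeIn (W ─ I) v                    <⟨ slack-transfer _ _ (f v) _ _ ⟦ lookup S v ∧ not (lookup I v) ⟧ split-slack gap ⟩
      f v ∸ ⟦ lookup S v ∧ not (lookup I v) ⟧ + indegreeIn (W ─ I) v
                                            ≡⟨ cong (_+ indegreeIn (W ─ I) v) (reduce-as-∸ S I f v) ⟨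
      reduce S I f v + indegreeIn (W ─ I) v ∎
      where
      open ≤-Reasoning
      split-slack : degreeIn (W ─ I) v + degreeIn (W ∩ I) v < f v + (indegreeIn (W ─ I) v + indegreeIn (W ∩ I) v)
      split-slack = subst₂ (λ d i → d < f v + i) (count-─∩ W I (Adj G v)) (count-─∩ W I (λ w → t w v))
        (slack (p─q⊆p W I v∈W─I))
      gap = kernel-gap (x∈p─q⇒x∉q W I v∈W─I)

  online : ∀ k W f → weight W f < k → Slack W f → OnlineChoosable G W f
  online (suc k) W f bound slack = step (λ _ → slack⇒positive W f slack) respond
    where
    respond : ∀ S → S ⊆ W → Nonempty S →
      Σ (Subset n) λ I → I ⊆ S × Independent G I × OnlineChoosable G (W ─ I) (reduce S I f)
    respond S S⊆W (s , s∈S) = I , I⊆S , independent , online k (W ─ I) (reduce S I f) lighter (slack-preserved S⊆W K slack)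
      where
      K = kernel (suc ∣ S ∣) S ≤-refl
      open Kernel K
      lighter : weight (W ─ I) (reduce S I f) < k
      lighter = <-≤-trans (weight-decreases s∈S S⊆W (slack⇒positive W f slack (S⊆W s∈S))) (≤-pred bound)

shortfall : Graph n → (Fin n → ℕ) → Fin n → ℕ
shortfall G f v = suc (deg G v) ∸ f v

hall-from-edge-counts : (G : Graph n) (f : Fin n → ℕ) (A : Subset n) →
  (∀ X → edgesIn G A X + crossEdges G A X ≥ Σᵥ (λ v → ⟦ lookup X v ⟧ * shortfall G f v)) →
  HallCondition (ascendingEdges G A) (shortfall G f)
hall-from-edge-counts G f A edge-counts = HallCondition-fromSubsets λ X → begin
  demand (shortfall G f) (lookup X)               ≡⟨ Σᵥ≡∑ (λ v → ⟦ lookup X v ⟧ * shortfall G f v) ⟨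
  Σᵥ (λ v → ⟦ lookup X v ⟧ * shortfall G f v)     ≤⟨ edge-counts X ⟩
  edgesIn G A X + crossEdges G A X                ≤⟨ edgesIn+crossEdges≤arcsMeeting G A X ⟩
  arcsMeeting (ascendingEdges G A) (lookup X)     ∎
  where open ≤-Reasoning

choosable-from-orientation : (G : Graph n) (f : Fin n → ℕ) (A : Subset n) → Independent G A →
  Orientation (ascendingEdges G A) (shortfall G f) → OnlineChoosable G ⊤ f
choosable-from-orientation G f A A-independent o = online (suc (weight ⊤ f)) ⊤ f ≤-refl initial-slack
  where
  open Orientation o

  arc⇒adj : ∀ u w → arc u w ≡ true → Adj G u w ≡ true
  arc⇒adj u w a = Sum.[ ascendingEdges⇒adj G A , trans (adj-sym G u w) ∘ ascendingEdges⇒adj G A {w} {u} ]′ (arc⇒edge u w a)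

  arc-meets-A : ∀ u w → arc u w ≡ true → u ∈ A ⊎ w ∈ A
  arc-meets-A u w a = Sum.[ ascendingEdges⇒meets G A , Sum.swap ∘ ascendingEdges⇒meets G A {w} {u} ]′ (arc⇒edge u w a)

  open OnlineFromOrientation G A A-independent arc arc⇒adj arc-meets-A arc-asymmetric

  initial-slack : Slack ⊤ f
  initial-slack {v} _ = begin-strict
    degreeIn ⊤ v                 ≡⟨ trans (count-⊤ (Adj G v)) (sym (Σᵥ≡∑ (λ w → ⟦ Adj G v w ⟧))) ⟩
    deg G v                      <⟨ ≤-refl ⟩
    suc (deg G v)                ≤⟨ m≤n+m∸n (suc (deg G v)) (f v) ⟩
    f v + shortfall G f v        ≤⟨ +-monoʳ-≤ (f v) (demand≤indegree v) ⟩
    f v + indegree arc v         ≡⟨ cong (f v +_) (count-⊤ (λ w → arc w v)) ⟨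
    f v + indegreeIn ⊤ v         ∎
    where open ≤-Reasoning

lemma2p3 : ∀ {n} (G : Graph n) (f : Fin n → ℕ) →
    (∀ v → f v ≤ suc (deg G v)) →
    (Σ (Subset n) λ A → Independent G A ×
      (∀ (X : Subset n) →
        edgesIn G A X + crossEdges G A X ≥
          Σᵥ (λ v → ⟦ lookup X v ⟧ * (suc (deg G v) ∸ f v)))) →
    OnlineChoosable G ⊤ f
lemma2p3 G f _ (A , A-independent , edge-counts) =
  choosable-from-orientation G f A A-independent
    (hakimi (ascendingEdges-asymmetric G A) (hall-from-edge-counts G f A edge-counts))
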